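{- Let $\mathcal{P}=\{2413, 2431, 4213, 3412, 3421, 4231, 4321, 4312\}$. The only simple permutations of length at least 2 that avoid $\mathcal{P}$ are $12$, $21$, $3142$ and $41352$.
   Context: Pattern containment: $\pi$ contains $p$ if some subsequence is order-isomorphic to $p$; $\pi$ avoids $\mathcal{P}$ if it contains no pattern in $\mathcal{P}$. An interval of an $n$-permutation is a factor whose values form a set of consecutive integers; it is trivial if its length is $0$, $1$ or $n$; a permutation is simple if all its intervals are trivial. -}

module Defs where

open import Data.Nat using (ℕ; suc; _≤_; _<_; _+_)
open import Data.List using (List; []; _∷_; _++_; length; map; upTo)
open import Data.List.Membership.Propositional using (_∈_)
open import Data.List.Relation.Binary.Permutation.Propositional using (_↭_)
open import Data.List.Relation.Binary.Sublist.Propositional using (_⊆_)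
open import Data.List.Relation.Binary.Pointwise using (Pointwise)
open import Data.List.Relation.Unary.Any using (Any)
open import Data.Product using (Σ; ∃; _×_)
open import Data.Sum using (_⊎_)
open import Data.Unit using (⊤)
open import Data.Empty using (⊥)
open import Function.Bundles using (_⇔_)
open import Relation.Binary.PropositionalEquality using (_≡_)
open import Relation.Nullary using (¬_)

-- Permutations in one-line notation: a list of naturals that is a
-- rearrangement of 1, 2, ..., n where n is its length.
IsPerm : List ℕ → Set
IsPerm π = π ↭ map suc (upTo (length π))

OrderIso : List ℕ → List ℕ → Set
OrderIso [] [] = ⊤
OrderIso [] (_ ∷ _) = ⊥
OrderIso (_ ∷ _) [] = ⊥
OrderIso (x ∷ xs) (y ∷ ys) =
  Pointwise (λ a b → ((x < a) ⇔ (y < b)) × ((a < x) ⇔ (b < y))) xs ys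
  × OrderIso xs ys

Contains : List ℕ → List ℕ → Set
Contains π p = ∃ λ σ → (σ ⊆ π) × OrderIso σ p

Avoids : List ℕ → List (List ℕ) → Set
Avoids π 𝒫 = ∀ p → p ∈ 𝒫 → ¬ Contains π p

Factor : List ℕ → List ℕ → Set
Factor f π = ∃ λ pre → ∃ λ suf → π ≡ pre ++ f ++ suf

Consecutive : List ℕ → Set
Consecutive f = ∃ λ c → ∀ v → (v ∈ f) ⇔ ((c ≤ v) × (v < c + length f))

IsInterval : List ℕ → List ℕ → Set
IsInterval π f = Factor f π × Consecutive f

Trivial : List ℕ → List ℕ → Set
Trivial π f = (length f ≡ 0) ⊎ (length f ≡ 1) ⊎ (length f ≡ length π)

Simple : List ℕ → Set
Simple π = ∀ f → IsInterval π f → Trivial π f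

𝒫 : List (List ℕ)
𝒫 = (2 ∷ 4 ∷ 1 ∷ 3 ∷ []) ∷ (2 ∷ 4 ∷ 3 ∷ 1 ∷ []) ∷ (4 ∷ 2 ∷ 1 ∷ 3 ∷ [])
  ∷ (3 ∷ 4 ∷ 1 ∷ 2 ∷ []) ∷ (3 ∷ 4 ∷ 2 ∷ 1 ∷ []) ∷ (4 ∷ 2 ∷ 3 ∷ 1 ∷ [])
  ∷ (4 ∷ 3 ∷ 2 ∷ 1 ∷ []) ∷ (4 ∷ 3 ∷ 1 ∷ 2 ∷ []) ∷ []

module Submission where

-- Avoiding 𝒫 says exactly this: whenever the largest of four entries of a subsequence is one of
-- its first two, the other of those two lies below the last two. So if the maximum n of π is
-- followed by at least two entries, everything before n lies below everything after it. A simple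
-- permutation of length at least 3 has no such split into two nonempty blocks (the first block,
-- or the second if the first is a single entry, would be a proper interval), and n cannot be last
-- for the same reason. Hence π = α n y, and the same argument with m = n - 1 in place of n (which
-- can be neither y nor the entry right before n) gives π = m β n y. If |β| ≥ 3, the first two
-- entries of β lie below all others and form the interval {1, 2}; |β| = 1, 2 leave 3142 and 41352.

open import Defs
open import Data.Nat using (ℕ; zero; suc; pred; _≤_; _<_; _+_; z≤n; s≤s; _≟_; _≤?_; _<?_; >-nonZero)
open import Data.Nat.Properties
open import Data.Empty using (⊥; ⊥-elim)
open import Data.List using (List; []; _∷_; length; _++_; map; applyUpTo)
open import Data.List.Properties using (length-++; length-applyUpTo; ++-identityʳ; ++-assoc; ≡-dec)
open import Data.List.Membership.Propositional using (_∈_; find; lose)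
open import Data.List.Membership.Propositional.Properties
  using (∈-∃++; ∈-++⁺ˡ; ∈-++⁺ʳ; ∈-++⁻; ∈-map⁺; ∈-map⁻; ∈-upTo⁺; ∈-upTo⁻; ∈-applyUpTo⁺; ∈-applyUpTo⁻)
open import Data.List.Membership.DecPropositional _≟_ using (_∈?_)
import Data.List.Membership.DecPropositional as DecMembership
open import Data.List.Relation.Binary.Permutation.Propositional
  using (_↭_; ↭-refl; ↭-sym; ↭-trans; ↭-reflexive; ↭⇒↭ₛ; swap; prep; module PermutationReasoning)
open import Data.List.Relation.Binary.Permutation.Propositional.Properties
  using (∈-resp-↭; All-resp-↭; ↭-length; shift; shifts; ∷↭∷ʳ)
import Data.List.Relation.Binary.Permutation.Setoid.Properties as Permutationₛ
import Data.List.Relation.Binary.Pointwise as Pointwise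
open import Data.List.Relation.Binary.Pointwise using (Pointwise; []; _∷_)
open import Data.List.Relation.Binary.Sublist.Propositional
  using (_⊆_; []; _∷_; _∷ʳ_; ⊆-refl; ⊆-trans; minimum; from∈)
open import Data.List.Relation.Binary.Sublist.Propositional.Properties using (All-resp-⊆; ++⁺ˡ; ++⁺ʳ; ++⁺)
open import Data.List.Relation.Unary.All as All using (All; []; _∷_)
import Data.List.Relation.Unary.All.Properties as All
open import Data.List.Relation.Unary.AllPairs using (AllPairs; []; _∷_)
open import Data.List.Relation.Unary.Any using (here; there; any?)
open import Data.List.Relation.Unary.Linked using ([-]; _∷_)
open import Data.List.Relation.Unary.Linked.Properties using (Linked⇒AllPairs)
open import Data.List.Relation.Unary.Unique.Propositional using (Unique)
import Data.List.Relation.Unary.Unique.Propositional.Properties as Unique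
open import Data.Product using (_×_; _,_; proj₁; proj₂; uncurry)
open import Data.Sum using (_⊎_; inj₁; inj₂; [_,_]′)
import Data.Sum as Sum
open import Data.Unit using (tt)
open import Function.Bundles using (_⇔_; mk⇔; Equivalence)
open import Relation.Binary using (tri<; tri≈; tri>)
open import Relation.Binary.PropositionalEquality
open import Relation.Nullary using (¬_; yes; no; contradiction)
open import Relation.Nullary.Decidable using (Dec; True; toWitness; from-yes; _×-dec_; _⊎-dec_; _→-dec_; ¬?)
import Relation.Nullary.Decidable as Dec

private
  remove-∈ : ∀ {A : Set} {x y : A} xs {ys} → x ∈ xs ++ y ∷ ys → x ≢ y → x ∈ xs ++ ys
  remove-∈ []       (here refl)  x≢y = contradiction refl x≢y
  remove-∈ []       (there x∈ys) x≢y = x∈ys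
  remove-∈ (z ∷ xs) (here refl)  x≢y = here refl
  remove-∈ (z ∷ xs) (there x∈)   x≢y = there (remove-∈ xs x∈ x≢y)

Unique⇒length≤ : ∀ {A : Set} {xs ys : List A} → Unique xs → (∀ {x} → x ∈ xs → x ∈ ys) → length xs ≤ length ys
Unique⇒length≤ {xs = []}     _               _     = z≤n
Unique⇒length≤ {xs = x ∷ xs} (x∉xs ∷ xs!) xs⊆ys with ys₁ , ys₂ , refl ← ∈-∃++ (xs⊆ys (here refl)) =
  subst (suc (length xs) ≤_) (sym (length-split ys₁))
    (s≤s (Unique⇒length≤ xs! λ z∈xs → remove-∈ ys₁ (xs⊆ys (there z∈xs)) (λ z≡x → All.lookup x∉xs z∈xs (sym z≡x))))
  where
  length-split : ∀ zs {zs′} → length (zs ++ x ∷ zs′) ≡ suc (length (zs ++ zs′))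
  length-split []       = refl
  length-split (_ ∷ zs) = cong suc (length-split zs)

Unique-resp-⊆ : ∀ {A : Set} {xs ys : List A} → xs ⊆ ys → Unique ys → Unique xs
Unique-resp-⊆ []          _             = []
Unique-resp-⊆ (y ∷ʳ xs⊆ys) (_ ∷ ys!)     = Unique-resp-⊆ xs⊆ys ys!
Unique-resp-⊆ (refl ∷ xs⊆ys) (y∉ys ∷ ys!) = All-resp-⊆ xs⊆ys y∉ys ∷ Unique-resp-⊆ xs⊆ys ys!

All-insert : ∀ {A : Set} {P : A → Set} xs {zs v} → P v → All P (xs ++ zs) → All P (xs ++ v ∷ zs)
All-insert xs Pv Pxs++zs = All.++⁺ (All.++⁻ˡ xs Pxs++zs) (Pv ∷ All.++⁻ʳ xs Pxs++zs)

shift₂ : ∀ {A : Set} (u v : A) xs ys zs → xs ++ u ∷ ys ++ v ∷ zs ↭ u ∷ v ∷ xs ++ ys ++ zs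
shift₂ u v xs ys zs = begin
  xs ++ u ∷ ys ++ v ∷ zs    ↭⟨ shift u xs _ ⟩
  u ∷ xs ++ ys ++ v ∷ zs    ≡⟨ cong (u ∷_) (++-assoc xs ys _) ⟨
  u ∷ (xs ++ ys) ++ v ∷ zs  ↭⟨ prep u (shift v (xs ++ ys) zs) ⟩
  u ∷ v ∷ (xs ++ ys) ++ zs  ≡⟨ cong (λ l → u ∷ v ∷ l) (++-assoc xs ys zs) ⟩
  u ∷ v ∷ xs ++ ys ++ zs    ∎
  where open PermutationReasoning

⊆-insert : ∀ {A : Set} xs {v : A} {zs} → xs ++ zs ⊆ xs ++ v ∷ zs
⊆-insert xs = ++⁺ ⊆-refl (_ ∷ʳ ⊆-refl)

2≤length-∷-∷ʳ : ∀ {A : Set} (x : A) xs y → 2 ≤ length (x ∷ xs ++ y ∷ [])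
2≤length-∷-∷ʳ x xs y = s≤s (subst (1 ≤_) (sym (length-++ xs)) (m≤n+m 1 (length xs)))

-- Sets of consecutive integers

ConsecutiveFrom : ℕ → List ℕ → Set
ConsecutiveFrom c f = ∀ v → (v ∈ f) ⇔ ((c ≤ v) × (v < c + length f))

segment : ℕ → ℕ → List ℕ
segment c k = applyUpTo (c +_) k

module _ {c k : ℕ} where

  ∈-segment⁺ : ∀ {v} → c ≤ v → v < c + k → v ∈ segment c k
  ∈-segment⁺ c≤v v<c+k with _ , refl ← m≤n⇒∃[o]m+o≡n c≤v =
    ∈-applyUpTo⁺ (c +_) (+-cancelˡ-< c _ _ v<c+k)

  ∈-segment⁻ : ∀ {v} → v ∈ segment c k → c ≤ v × v < c + k
  ∈-segment⁻ v∈ with i , i<k , refl ← ∈-applyUpTo⁻ (c +_) v∈ = m≤m+n c i , +-monoʳ-< c i<k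

  segment! : Unique (segment c k)
  segment! = Unique.applyUpTo⁺₁ (c +_) k λ i<j _ → <⇒≢ (+-monoʳ-< c i<j)

withinSegment⇒consecutive : ∀ {f} c → Unique f → (∀ {v} → v ∈ f → c ≤ v × v < c + length f) → ConsecutiveFrom c f
withinSegment⇒consecutive {f} c f! bounds v = mk⇔ bounds fill
  where
  fill : c ≤ v × v < c + length f → v ∈ f
  fill (c≤v , v<) with v ∈? f
  ... | yes v∈f = v∈f
  -- otherwise the |f| + 1 distinct values v ∷ f would fit into a segment of length |f|
  ... | no  v∉f = contradiction
    (Unique⇒length≤ (All.tabulate (λ u∈f v≡u → v∉f (subst (_∈ f) (sym v≡u) u∈f)) ∷ f!) λ where
      (here refl) → ∈-segment⁺ c≤v v<
      (there u∈f) → uncurry ∈-segment⁺ (bounds u∈f))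
    (λ too-long → 1+n≰n (≤-trans too-long (≤-reflexive (length-applyUpTo (c +_) _))))

DownClosed : List ℕ → Set
DownClosed f = ∀ {u v} → v ∈ f → 1 ≤ u → u < v → u ∈ f

downClosed⇒consecutive : ∀ {f} → Unique f → (∀ {v} → v ∈ f → 1 ≤ v) → DownClosed f → ConsecutiveFrom 1 f
downClosed⇒consecutive {f} f! positive closed = withinSegment⇒consecutive 1 f! λ v∈f → positive v∈f , s≤s (≤length v∈f)
  where
  ≤length : ∀ {v} → v ∈ f → v ≤ length f
  ≤length {v} v∈f = subst (_≤ length f) (length-applyUpTo (1 +_) v)
    (Unique⇒length≤ segment! λ u∈ → below-or-at (∈-segment⁻ u∈))
    where
    below-or-at : ∀ {u} → 1 ≤ u × u < 1 + v → u ∈ f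
    below-or-at {u} (1≤u , s≤s u≤v) with u ≟ v
    ... | yes refl = v∈f
    ... | no  u≢v  = closed v∈f 1≤u (≤∧≢⇒< u≤v u≢v)

adjacent-consecutive : ∀ v → ConsecutiveFrom v (v ∷ suc v ∷ []) × ConsecutiveFrom v (suc v ∷ v ∷ [])
adjacent-consecutive v =
  withinSegment⇒consecutive v ((<⇒≢ (n<1+n v) ∷ []) ∷ [] ∷ []) (λ where
    (here refl)         → ≤-refl , m<m+n v (s≤s z≤n)
    (there (here refl)) → n≤1+n v , ≤-reflexive (+-comm 2 v)) ,
  withinSegment⇒consecutive v ((≢-sym (<⇒≢ (n<1+n v)) ∷ []) ∷ [] ∷ []) (λ where
    (here refl)         → n≤1+n v , ≤-reflexive (+-comm 2 v)
    (there (here refl)) → ≤-refl , m<m+n v (s≤s z≤n))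

-- Patterns

module _ {S : ℕ → Set} (f : ℕ → ℕ) (f-mono : ∀ {i j} → S i → S j → i < j → f i < f j) where

  private
    f-<-⇔ : ∀ {i j} → S i → S j → (f i < f j) ⇔ (i < j)
    f-<-⇔ {i} {j} Si Sj = mk⇔ reflect (f-mono Si Sj)
      where
      reflect : f i < f j → i < j
      reflect fi<fj with <-cmp i j
      ... | tri< i<j _ _ = i<j
      ... | tri≈ _ refl _ = contradiction fi<fj (<-irrefl refl)
      ... | tri> _ _ j<i = contradiction fi<fj (<-asym (f-mono Sj Si j<i))

  map-orderIso : ∀ p → All S p → OrderIso (map f p) p
  map-orderIso []      _         = tt
  map-orderIso (i ∷ p) (Si ∷ Sp) = pointwise Sp , map-orderIso p Sp
    where
    pointwise : ∀ {q} → All S q → Pointwise (λ a b → ((f i < a) ⇔ (i < b)) × ((a < f i) ⇔ (b < i))) (map f q) q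
    pointwise []        = []
    pointwise (Sj ∷ Sq) = (f-<-⇔ Si Sj , f-<-⇔ Sj Si) ∷ pointwise Sq

nth : List ℕ → ℕ → ℕ
nth []       _       = 0
nth (v ∷ vs) zero    = v
nth (v ∷ vs) (suc i) = nth vs i

nth-∈ : ∀ vs {i} → i < length vs → nth vs i ∈ vs
nth-∈ (v ∷ vs) {zero}  _         = here refl
nth-∈ (v ∷ vs) {suc i} (s≤s i<n) = there (nth-∈ vs i<n)

nth-strictMono : ∀ {vs i j} → AllPairs _<_ vs → i < j → j < length vs → nth vs i < nth vs j
nth-strictMono {v ∷ vs} {zero}  {suc j} (v<vs ∷ _)   _         (s≤s j<n) = All.lookup v<vs (nth-∈ vs j<n)
nth-strictMono {v ∷ vs} {suc i} {suc j} (_ ∷ vs↑) (s≤s i<j) (s≤s j<n) = nth-strictMono vs↑ i<j j<n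

-- Pattern entries are 1-based: entry i of a pattern stands for the i-th smallest value.
rank : List ℕ → ℕ → ℕ
rank vs i = nth vs (pred i)

rank-strictMono : ∀ {vs i j} → AllPairs _<_ vs → 1 ≤ i × i ≤ length vs → 1 ≤ j × j ≤ length vs → i < j → rank vs i < rank vs j
rank-strictMono {i = suc i} {j = suc j} vs↑ _ (_ , j≤n) (s≤s i<j) = nth-strictMono vs↑ i<j j≤n

𝒫-entries : All (All (λ i → 1 ≤ i × i ≤ 4)) 𝒫
𝒫-entries = from-yes (All.all? (All.all? (λ i → 1 ≤? i ×-dec i ≤? 4)) 𝒫)

module Avoiding {π : List ℕ} (π! : Unique π) (avoids : Avoids π 𝒫) where

  forbidden : ∀ p {p∈𝒫 : True (DecMembership._∈?_ (≡-dec _≟_) p 𝒫)} {a b c d} →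
              a < b → b < c → c < d → map (rank (a ∷ b ∷ c ∷ d ∷ [])) p ⊆ π → ⊥
  forbidden p {p∈𝒫} {a} {b} {c} {d} a<b b<c c<d occurrence =
    avoids p (toWitness p∈𝒫) (_ , occurrence , map-orderIso _ (rank-strictMono increasing) p (All.lookup 𝒫-entries (toWitness p∈𝒫)))
    where
    increasing : AllPairs _<_ (a ∷ b ∷ c ∷ d ∷ [])
    increasing = Linked⇒AllPairs <-trans (a<b ∷ b<c ∷ c<d ∷ [-])

  Precede : ℕ → ℕ → List ℕ → Set
  Precede x y δ = (x ∷ y ∷ δ ⊆ π) ⊎ (y ∷ x ∷ δ ⊆ π)

  Precede-shrink : ∀ {x y δ τ} → τ ⊆ δ → Precede x y δ → Precede x y τ
  Precede-shrink τ⊆δ = Sum.map (⊆-trans (refl ∷ refl ∷ τ⊆δ)) (⊆-trans (refl ∷ refl ∷ τ⊆δ))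

  headPair-below : ∀ {x y p q} → Precede x y (p ∷ q ∷ []) → x < y → p < y → q < y → x < p × x < q
  headPair-below {x} {y} {p} {q} occ x<y p<y q<y
    with Unique-resp-⊆ ([ ⊆-trans (refl ∷ y ∷ʳ ⊆-refl) , ⊆-trans (y ∷ʳ ⊆-refl) ]′ occ) π!
  ... | (x≢p ∷ x≢q ∷ []) ∷ (p≢q ∷ []) ∷ _ with <-cmp x p | <-cmp x q
  ... | tri< x<p _ _ | tri< x<q _ _ = x<p , x<q
  ... | tri≈ _ x≡p _ | _            = contradiction x≡p x≢p
  ... | _            | tri≈ _ x≡q _ = contradiction x≡q x≢q
  ... | tri> _ _ p<x | tri< x<q _ _ =
    ⊥-elim ([ forbidden (2 ∷ 4 ∷ 1 ∷ 3 ∷ []) p<x x<q q<y , forbidden (4 ∷ 2 ∷ 1 ∷ 3 ∷ []) p<x x<q q<y ]′ occ)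
  ... | tri< x<p _ _ | tri> _ _ q<x =
    ⊥-elim ([ forbidden (2 ∷ 4 ∷ 3 ∷ 1 ∷ []) q<x x<p p<y , forbidden (4 ∷ 2 ∷ 3 ∷ 1 ∷ []) q<x x<p p<y ]′ occ)
  ... | tri> _ _ p<x | tri> _ _ q<x with <-cmp p q
  ...   | tri< p<q _ _ =
    ⊥-elim ([ forbidden (3 ∷ 4 ∷ 1 ∷ 2 ∷ []) p<q q<x x<y , forbidden (4 ∷ 3 ∷ 1 ∷ 2 ∷ []) p<q q<x x<y ]′ occ)
  ...   | tri≈ _ p≡q _ = contradiction p≡q p≢q
  ...   | tri> _ _ q<p =
    ⊥-elim ([ forbidden (3 ∷ 4 ∷ 2 ∷ 1 ∷ []) q<p p<x x<y , forbidden (4 ∷ 3 ∷ 2 ∷ 1 ∷ []) q<p p<x x<y ]′ occ)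

  below-tail : ∀ {x y δ} → Precede x y δ → x < y → All (_< y) δ → 2 ≤ length δ → All (x <_) δ
  below-tail {δ = []}    _ _ _ ()
  below-tail {δ = _ ∷ []} _ _ _ (s≤s ())
  below-tail {δ = p ∷ q ∷ rest} occ x<y (p<y ∷ q<y ∷ rest<y) _
    with x<p , x<q ← headPair-below (Precede-shrink (refl ∷ refl ∷ minimum _) occ) x<y p<y q<y =
    x<p ∷ x<q ∷ All.tabulate λ u∈rest →
      proj₂ (headPair-below (Precede-shrink (refl ∷ q ∷ʳ from∈ u∈rest) occ) x<y p<y (All.lookup rest<y u∈rest))

-- Permutations and simple permutations

module Permutation {π : List ℕ} (π-perm : IsPerm π) where

  n : ℕ
  n = length π

  ∈π⇒bounded : ∀ {v} → v ∈ π → 1 ≤ v × v ≤ n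
  ∈π⇒bounded v∈π with i , i∈ , refl ← ∈-map⁻ suc (∈-resp-↭ π-perm v∈π) = s≤s z≤n , ∈-upTo⁻ i∈

  bounded⇒∈π : ∀ {v} → 1 ≤ v → v ≤ n → v ∈ π
  bounded⇒∈π {suc i} _ v≤n = ∈-resp-↭ (↭-sym π-perm) (∈-map⁺ suc (∈-upTo⁺ v≤n))

  π! : Unique π
  π! = Permutationₛ.Unique-resp-↭ (setoid ℕ) (↭⇒↭ₛ (↭-sym π-perm)) (Unique.map⁺ suc-injective (Unique.upTo⁺ n))

  ↭π-unique : ∀ {xs} → π ↭ xs → Unique xs
  ↭π-unique π↭xs = Permutationₛ.Unique-resp-↭ (setoid ℕ) (↭⇒↭ₛ π↭xs) π!

  ↭π-bounded : ∀ {xs} → π ↭ xs → All (λ v → 1 ≤ v × v ≤ n) xs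
  ↭π-bounded π↭xs = All-resp-↭ π↭xs (All.tabulate ∈π⇒bounded)

  below-max : ∀ {rest} → π ↭ n ∷ rest → All (_< n) rest
  below-max π↭ with (n∉rest ∷ _) ← ↭π-unique π↭ | (_ ∷ rest-bounded) ← ↭π-bounded π↭ =
    All.zipWith (λ (bounded , n≢v) → ≤∧≢⇒< (proj₂ bounded) (≢-sym n≢v)) (rest-bounded , n∉rest)

  m : ℕ
  m = pred n

  noRepeat : ∀ {v} → v ∷ v ∷ [] ⊆ π → ⊥
  noRepeat vv⊆π with (v≢v ∷ []) ∷ _ ← Unique-resp-⊆ vv⊆π π! = v≢v refl

  below-second : ∀ {rest} → π ↭ m ∷ n ∷ rest → All (_< m) rest
  below-second π↭ with (_ ∷ m∉rest) ∷ _ ← ↭π-unique π↭ =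
    All.zipWith (λ (v<n , m≢v) → ≤∧≢⇒< (suc[m]≤n⇒m≤pred[n] v<n) (≢-sym m≢v))
      (All.tail (below-max (↭-trans π↭ (swap m n ↭-refl))) , m∉rest)

length-2 : ∀ {π} → IsPerm π → length π ≡ 2 → (π ≡ 1 ∷ 2 ∷ []) ⊎ (π ≡ 2 ∷ 1 ∷ [])
length-2 {x ∷ y ∷ []} π-perm _ with (x≢y ∷ []) ∷ _ ← Permutation.π! π-perm =
  go (∈π⇒bounded (here refl)) (∈π⇒bounded (there (here refl)))
  where
  open Permutation π-perm
  go : 1 ≤ x × x ≤ 2 → 1 ≤ y × y ≤ 2 → (x ∷ y ∷ [] ≡ 1 ∷ 2 ∷ []) ⊎ (x ∷ y ∷ [] ≡ 2 ∷ 1 ∷ [])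
  go (s≤s z≤n , s≤s z≤n)       (s≤s z≤n , s≤s z≤n)       = contradiction refl x≢y
  go (s≤s z≤n , s≤s z≤n)       (s≤s z≤n , s≤s (s≤s z≤n)) = inj₁ refl
  go (s≤s z≤n , s≤s (s≤s z≤n)) (s≤s z≤n , s≤s z≤n)       = inj₂ refl
  go (s≤s z≤n , s≤s (s≤s z≤n)) (s≤s z≤n , s≤s (s≤s z≤n)) = contradiction refl x≢y

module SimplePermutation {π : List ℕ} (π-perm : IsPerm π) (3≤n : 3 ≤ length π) (simple : Simple π) where

  open Permutation π-perm

  properInterval⇒⊥ : ∀ {f} → Factor f π → Consecutive f → 2 ≤ length f → length f < n → ⊥
  properInterval⇒⊥ f-factor f-consecutive 2≤|f| |f|<n with simple _ (f-factor , f-consecutive)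
  ... | inj₁ |f|≡0        = contradiction (subst (2 ≤_) |f|≡0 2≤|f|) λ ()
  ... | inj₂ (inj₁ |f|≡1) = contradiction (subst (2 ≤_) |f|≡1 2≤|f|) λ { (s≤s ()) }
  ... | inj₂ (inj₂ |f|≡n) = <-irrefl |f|≡n |f|<n

  noAdjacentValues : ∀ {pre u v suf} → π ≡ pre ++ u ∷ v ∷ suf → (v ≡ suc u) ⊎ (u ≡ suc v) → ⊥
  noAdjacentValues {pre} {u} {v} {suf} eq adjacent = properInterval⇒⊥ (pre , suf , eq) (consecutive adjacent) ≤-refl 3≤n
    where
    consecutive : (v ≡ suc u) ⊎ (u ≡ suc v) → Consecutive (u ∷ v ∷ [])
    consecutive (inj₁ v≡1+u) = u , subst (λ w → ConsecutiveFrom u (u ∷ w ∷ [])) (sym v≡1+u) (proj₁ (adjacent-consecutive u))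
    consecutive (inj₂ u≡1+v) = v , subst (λ w → ConsecutiveFrom v (w ∷ v ∷ [])) (sym u≡1+v) (proj₂ (adjacent-consecutive v))

  module _ {f g : List ℕ} (π↭f++g : π ↭ f ++ g) (f<g : All (λ v → All (v <_) g) f) where

    lowerPart-consecutive : ConsecutiveFrom 1 f
    lowerPart-consecutive = downClosed⇒consecutive f! (λ v∈f → proj₁ (All.lookup f-bounded v∈f)) closed
      where
      f! : Unique f
      f! = Unique-resp-⊆ (++⁺ʳ g ⊆-refl) (↭π-unique π↭f++g)
      f-bounded : All (λ v → 1 ≤ v × v ≤ n) f
      f-bounded = All.++⁻ˡ f (↭π-bounded π↭f++g)
      closed : DownClosed f
      closed {u} v∈f 1≤u u<v with ∈-++⁻ f (∈-resp-↭ π↭f++g (bounded⇒∈π 1≤u (<⇒≤ (<-≤-trans u<v (proj₂ (All.lookup f-bounded v∈f))))))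
      ... | inj₁ u∈f = u∈f
      ... | inj₂ u∈g = contradiction (All.lookup (All.lookup f<g v∈f) u∈g) (<-asym u<v)

    upperPart-consecutive : ConsecutiveFrom (suc (length f)) g
    upperPart-consecutive = withinSegment⇒consecutive _ g! bounds
      where
      g! : Unique g
      g! = Unique-resp-⊆ (++⁺ˡ f ⊆-refl) (↭π-unique π↭f++g)
      bounds : ∀ {w} → w ∈ g → suc (length f) ≤ w × w < suc (length f) + length g
      bounds {w} w∈g = above-f , s≤s (subst (w ≤_) n≡|f|+|g| (proj₂ w-bounded))
        where
        w-bounded : 1 ≤ w × w ≤ n
        w-bounded = All.lookup (All.++⁻ʳ f (↭π-bounded π↭f++g)) w∈g
        n≡|f|+|g| : n ≡ length f + length g
        n≡|f|+|g| = trans (↭-length π↭f++g) (length-++ f)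
        above-f : length f < w
        above-f with length f <? w
        ... | yes |f|<w = |f|<w
        ... | no  |f|≮w = contradiction -- w ≤ |f| would put w into the lower part f
          (All.lookup (All.lookup f<g (Equivalence.from (lowerPart-consecutive w) (proj₁ w-bounded , s≤s (≮⇒≥ |f|≮w)))) w∈g)
          (<-irrefl refl)

  noSumSplit : ∀ {α γ} → π ≡ α ++ γ → 1 ≤ length α → 1 ≤ length γ → All (λ a → All (a <_) γ) α → ⊥
  noSumSplit {α} {γ} eq 1≤|α| 1≤|γ| α<γ = split (m≤n⇒m<n∨m≡n 1≤|α|)
    where
    π↭α++γ : π ↭ α ++ γ
    π↭α++γ = ↭-reflexive eq
    n≡|α|+|γ| : n ≡ length α + length γ
    n≡|α|+|γ| = trans (cong length eq) (length-++ α)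
    split : (2 ≤ length α) ⊎ (1 ≡ length α) → ⊥
    split (inj₁ 2≤|α|) =
      properInterval⇒⊥ ([] , γ , eq) (1 , lowerPart-consecutive π↭α++γ α<γ) 2≤|α|
        (subst (length α <_) (sym n≡|α|+|γ|) (m<m+n (length α) 1≤|γ|))
    split (inj₂ 1≡|α|) =
      properInterval⇒⊥ (α , [] , trans eq (cong (α ++_) (sym (++-identityʳ γ)))) (_ , upperPart-consecutive π↭α++γ α<γ)
        (≤-pred (subst (3 ≤_) (trans n≡|α|+|γ| (cong (_+ length γ) (sym 1≡|α|))) 3≤n))
        (subst (length γ <_) (sym n≡|α|+|γ|) (m<n+m (length γ) 1≤|α|))

module Classification {π : List ℕ} (π-perm : IsPerm π) (3≤n : 3 ≤ length π) (simple : Simple π) (avoids : Avoids π 𝒫) where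

  open Permutation π-perm
  open SimplePermutation π-perm 3≤n simple
  open Avoiding π! avoids

  Exceptional : Set
  Exceptional = (π ≡ 3 ∷ 1 ∷ 4 ∷ 2 ∷ []) ⊎ (π ≡ 4 ∷ 1 ∷ 3 ∷ 5 ∷ 2 ∷ [])

  along : ∀ {xs ys} → π ≡ xs → ys ⊆ xs → ys ⊆ π
  along refl ys⊆π = ys⊆π

  n≡1+m : n ≡ suc m
  n≡1+m = sym (suc-pred n {{>-nonZero (≤-trans (s≤s z≤n) 3≤n)}})

  m<n : m < n
  m<n = subst (m <_) (sym n≡1+m) ≤-refl

  1≤m : 1 ≤ m
  1≤m = ≤-pred (≤-trans (s≤s (s≤s z≤n)) (subst (3 ≤_) n≡1+m 3≤n))

  maxLast⇒⊥ : ∀ {α} → π ≡ α ++ n ∷ [] → ⊥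
  maxLast⇒⊥ {[]}        eq = contradiction (subst (3 ≤_) (cong length eq) 3≤n) λ { (s≤s ()) }
  maxLast⇒⊥ {α@(_ ∷ _)} eq = noSumSplit eq (s≤s z≤n) (s≤s z≤n)
    (All.map (_∷ []) (All.++⁻ˡ α (below-max (↭-trans (↭-reflexive eq) (shift n α [])))))

  maxEarly⇒⊥ : ∀ {α γ} → π ≡ α ++ n ∷ γ → 2 ≤ length γ → ⊥
  maxEarly⇒⊥ {[]} {γ} eq 2≤|γ| =
    properInterval⇒⊥ (n ∷ [] , [] , trans eq (cong (n ∷_) (sym (++-identityʳ γ))))
      (1 , lowerPart-consecutive (↭-trans (↭-reflexive eq) (∷↭∷ʳ n γ)) (All.map (_∷ []) (below-max (↭-reflexive eq))))
      2≤|γ| (subst (length γ <_) (sym (cong length eq)) ≤-refl)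
  maxEarly⇒⊥ {α@(_ ∷ _)} {γ} eq 2≤|γ| = noSumSplit eq (s≤s z≤n) (s≤s z≤n) (All.tabulate λ x∈α →
    let x<n = All.lookup (All.++⁻ˡ α rest<n) x∈α
    in x<n ∷ below-tail (inj₁ (along eq (++⁺ (from∈ x∈α) ⊆-refl))) x<n (All.++⁻ʳ α rest<n) 2≤|γ|)
    where
    rest<n : All (_< n) (α ++ γ)
    rest<n = below-max (↭-trans (↭-reflexive eq) (shift n α γ))

  length-4 : ∀ {b y} → π ≡ 3 ∷ b ∷ 4 ∷ y ∷ [] → 1 ≤ b → b < 3 → 1 ≤ y → y < 3 → π ≡ 3 ∷ 1 ∷ 4 ∷ 2 ∷ []
  length-4 {1} {1} eq _ _ _ _ = ⊥-elim (noRepeat (along eq (3 ∷ʳ refl ∷ 4 ∷ʳ refl ∷ [])))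
  length-4 {1} {2} eq _ _ _ _ = eq
  length-4 {2}     eq _ _ _ _ = ⊥-elim (noAdjacentValues {pre = []} eq (inj₂ refl))
  length-4 {suc (suc (suc _))} _ _ (s≤s (s≤s (s≤s ()))) _ _
  length-4 {_} {suc (suc (suc _))} _ _ _ _ (s≤s (s≤s (s≤s ())))

  length-5 : ∀ {b c y} → π ≡ 4 ∷ b ∷ c ∷ 5 ∷ y ∷ [] → 1 ≤ b → b < 4 → 1 ≤ c → c < 4 → 1 ≤ y → y < 4 →
             π ≡ 4 ∷ 1 ∷ 3 ∷ 5 ∷ 2 ∷ []
  length-5 {1} {1}     eq _ _ _ _ _ _ = ⊥-elim (noRepeat (along eq (4 ∷ʳ refl ∷ refl ∷ minimum _)))
  length-5 {1} {2}     eq _ _ _ _ _ _ = ⊥-elim (noAdjacentValues {pre = 4 ∷ []} eq (inj₁ refl))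
  length-5 {1} {3} {1} eq _ _ _ _ _ _ = ⊥-elim (noRepeat (along eq (4 ∷ʳ refl ∷ 3 ∷ʳ 5 ∷ʳ refl ∷ [])))
  length-5 {1} {3} {2} eq _ _ _ _ _ _ = eq
  length-5 {1} {3} {3} eq _ _ _ _ _ _ = ⊥-elim (noRepeat (along eq (4 ∷ʳ 1 ∷ʳ refl ∷ 5 ∷ʳ refl ∷ [])))
  length-5 {2} {1}     eq _ _ _ _ _ _ = ⊥-elim (noAdjacentValues {pre = 4 ∷ []} eq (inj₂ refl))
  length-5 {2} {2}     eq _ _ _ _ _ _ = ⊥-elim (noRepeat (along eq (4 ∷ʳ refl ∷ refl ∷ minimum _)))
  length-5 {2} {3}     eq _ _ _ _ _ _ = ⊥-elim (noAdjacentValues {pre = 4 ∷ []} eq (inj₁ refl))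
  length-5 {3}         eq _ _ _ _ _ _ = ⊥-elim (noAdjacentValues {pre = []} eq (inj₂ refl))
  length-5 {suc (suc (suc (suc _)))} _ _ (s≤s (s≤s (s≤s (s≤s ())))) _ _ _ _
  length-5 {_} {suc (suc (suc (suc _)))} _ _ _ _ (s≤s (s≤s (s≤s (s≤s ())))) _ _
  length-5 {_} {_} {suc (suc (suc (suc _)))} _ _ _ _ _ _ (s≤s (s≤s (s≤s (s≤s ()))))

  others<m : ∀ α β {y} → π ≡ α ++ m ∷ β ++ n ∷ y ∷ [] → All (_< m) (α ++ β ++ y ∷ [])
  others<m α β eq = below-second (↭-trans (↭-reflexive eq) (shift₂ m n α β _))

  secondBeforeMax⇒⊥ : ∀ {a α b β y} → π ≡ (a ∷ α) ++ m ∷ (b ∷ β) ++ n ∷ y ∷ [] → ⊥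
  secondBeforeMax⇒⊥ {a} {α} {b} {β} {y} eq = noSumSplit eq (s≤s z≤n) (s≤s z≤n) (All.tabulate λ x∈α′ →
    let x<m = All.lookup (All.++⁻ˡ (a ∷ α) rest<m) x∈α′
    in x<m ∷ All-insert (b ∷ β) (<-trans x<m m<n)
         (below-tail (inj₁ (along eq (++⁺ (from∈ x∈α′) (refl ∷ ⊆-insert (b ∷ β)))))
           x<m (All.++⁻ʳ (a ∷ α) rest<m) (2≤length-∷-∷ʳ b β _)))
    where
    rest<m : All (_< m) ((a ∷ α) ++ (b ∷ β) ++ y ∷ [])
    rest<m = others<m (a ∷ α) (b ∷ β) eq

  secondFirst-length4 : ∀ {b y} → π ≡ m ∷ b ∷ n ∷ y ∷ [] → π ≡ 3 ∷ 1 ∷ 4 ∷ 2 ∷ []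
  secondFirst-length4 {b} {y} eq
    with _ ∷ (1≤b , _) ∷ _ ∷ (1≤y , _) ∷ [] ← ↭π-bounded (↭-reflexive eq)
       | b<m ∷ y<m ∷ [] ← others<m [] (b ∷ []) eq =
    length-4 (trans eq (cong (λ k → pred k ∷ b ∷ k ∷ y ∷ []) n≡4)) 1≤b (subst (b <_) m≡3 b<m) 1≤y (subst (y <_) m≡3 y<m)
    where
    n≡4 : n ≡ 4
    n≡4 = cong length eq
    m≡3 : m ≡ 3
    m≡3 = cong pred n≡4

  secondFirst-length5 : ∀ {b c y} → π ≡ m ∷ b ∷ c ∷ n ∷ y ∷ [] → π ≡ 4 ∷ 1 ∷ 3 ∷ 5 ∷ 2 ∷ []
  secondFirst-length5 {b} {c} {y} eq
    with _ ∷ (1≤b , _) ∷ (1≤c , _) ∷ _ ∷ (1≤y , _) ∷ [] ← ↭π-bounded (↭-reflexive eq)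
       | b<m ∷ c<m ∷ y<m ∷ [] ← others<m [] (b ∷ c ∷ []) eq =
    length-5 (trans eq (cong (λ k → pred k ∷ b ∷ c ∷ k ∷ y ∷ []) n≡5))
      1≤b (subst (b <_) m≡4 b<m) 1≤c (subst (c <_) m≡4 c<m) 1≤y (subst (y <_) m≡4 y<m)
    where
    n≡5 : n ≡ 5
    n≡5 = cong length eq
    m≡4 : m ≡ 4
    m≡4 = cong pred n≡5

  -- Both b and c then lie below everything else, so {b, c} = {1, 2} is an interval.
  secondFirst-long⇒⊥ : ∀ {b c d r y} → π ≡ m ∷ b ∷ c ∷ d ∷ r ++ n ∷ y ∷ [] → ⊥
  secondFirst-long⇒⊥ {b} {c} {d} {r} {y} eq with b<m ∷ c<m ∷ δ<m ← others<m [] (b ∷ c ∷ d ∷ r) eq =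
    properInterval⇒⊥ (m ∷ [] , _ , eq)
      (1 , lowerPart-consecutive (↭-trans (↭-reflexive eq) (shifts (m ∷ []) (b ∷ c ∷ [])))
             (below-rest (refl ∷ refl ∷ c ∷ʳ refl ∷ ⊆-insert r) b<m ∷ below-rest (refl ∷ b ∷ʳ refl ∷ refl ∷ ⊆-insert r) c<m ∷ []))
      ≤-refl 3≤n
    where
    below-rest : ∀ {x} → m ∷ x ∷ d ∷ r ++ y ∷ [] ⊆ m ∷ b ∷ c ∷ d ∷ r ++ n ∷ y ∷ [] → x < m →
                 All (x <_) (m ∷ d ∷ r ++ n ∷ y ∷ [])
    below-rest occ x<m =
      x<m ∷ All-insert (d ∷ r) (<-trans x<m m<n) (below-tail (inj₂ (along eq occ)) x<m δ<m (2≤length-∷-∷ʳ d r y))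

  secondBeforeMax : ∀ α β {y} → π ≡ α ++ m ∷ β ++ n ∷ y ∷ [] → Exceptional
  secondBeforeMax _       []              eq = ⊥-elim (noAdjacentValues eq (inj₁ n≡1+m))
  secondBeforeMax (_ ∷ _) (_ ∷ _)         eq = ⊥-elim (secondBeforeMax⇒⊥ eq)
  secondBeforeMax []      (_ ∷ [])        eq = inj₁ (secondFirst-length4 eq)
  secondBeforeMax []      (_ ∷ _ ∷ [])    eq = inj₂ (secondFirst-length5 eq)
  secondBeforeMax []      (_ ∷ _ ∷ _ ∷ _) eq = ⊥-elim (secondFirst-long⇒⊥ eq)

  maxPenultimate : ∀ {α y} → π ≡ α ++ n ∷ y ∷ [] → Exceptional
  maxPenultimate {α} {y} eq with y ≟ m
  ... | yes refl = ⊥-elim (noAdjacentValues eq (inj₂ n≡1+m))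
  ... | no y≢m with ∈-++⁻ α (subst (m ∈_) eq (bounded⇒∈π 1≤m (<⇒≤ m<n)))
  ...   | inj₂ (here m≡n)         = ⊥-elim (<-irrefl m≡n m<n)
  ...   | inj₂ (there (here m≡y)) = ⊥-elim (y≢m (sym m≡y))
  ...   | inj₁ m∈α with α₁ , β , refl ← ∈-∃++ m∈α = secondBeforeMax α₁ β (trans eq (++-assoc α₁ (m ∷ β) _))

  classify : Exceptional
  classify with ∈-∃++ (bounded⇒∈π (≤-trans (s≤s z≤n) 3≤n) ≤-refl)
  ... | _ , []        , eq = ⊥-elim (maxLast⇒⊥ eq)
  ... | _ , _ ∷ []    , eq = maxPenultimate eq
  ... | _ , _ ∷ _ ∷ _ , eq = ⊥-elim (maxEarly⇒⊥ eq (s≤s (s≤s z≤n)))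

-- Deciding containment and simplicity

_⇔?_ : ∀ {A B : Set} → Dec A → Dec B → Dec (A ⇔ B)
A? ⇔? B? = Dec.map′ (uncurry mk⇔) (λ A⇔B → Equivalence.to A⇔B , Equivalence.from A⇔B) ((A? →-dec B?) ×-dec (B? →-dec A?))

orderIso? : ∀ σ p → Dec (OrderIso σ p)
orderIso? []      []      = yes tt
orderIso? []      (_ ∷ _) = no λ ()
orderIso? (_ ∷ _) []      = no λ ()
orderIso? (x ∷ σ) (y ∷ p) =
  Pointwise.decidable (λ a b → ((x <? a) ⇔? (y <? b)) ×-dec ((a <? x) ⇔? (b <? y))) σ p ×-dec orderIso? σ p

sublists : List ℕ → List (List ℕ)
sublists []       = [] ∷ []
sublists (x ∷ xs) = map (x ∷_) (sublists xs) ++ sublists xs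

∈-sublists⁺ : ∀ {σ xs} → σ ⊆ xs → σ ∈ sublists xs
∈-sublists⁺ []                         = here refl
∈-sublists⁺ {xs = x ∷ xs} (.x ∷ʳ σ⊆xs)  = ∈-++⁺ʳ (map (x ∷_) (sublists xs)) (∈-sublists⁺ σ⊆xs)
∈-sublists⁺ {xs = x ∷ xs} (refl ∷ σ⊆xs) = ∈-++⁺ˡ (∈-map⁺ (x ∷_) (∈-sublists⁺ σ⊆xs))

∈-sublists⁻ : ∀ {σ xs} → σ ∈ sublists xs → σ ⊆ xs
∈-sublists⁻ {xs = []}     (here refl) = []
∈-sublists⁻ {xs = x ∷ xs} σ∈ with ∈-++⁻ (map (x ∷_) (sublists xs)) σ∈
... | inj₁ σ∈map with τ , τ∈ , refl ← ∈-map⁻ (x ∷_) σ∈map = refl ∷ ∈-sublists⁻ τ∈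
... | inj₂ σ∈     = x ∷ʳ ∈-sublists⁻ σ∈

contains? : ∀ π p → Dec (Contains π p)
contains? π p = Dec.map′
  (λ found → let σ , σ∈ , σ≅p = find found in σ , ∈-sublists⁻ σ∈ , σ≅p)
  (λ (σ , σ⊆π , σ≅p) → lose (∈-sublists⁺ σ⊆π) σ≅p)
  (any? (λ σ → orderIso? σ p) (sublists π))

avoids? : ∀ π 𝒬 → Dec (Avoids π 𝒬)
avoids? π 𝒬 = Dec.map′ (λ all p p∈𝒬 → All.lookup all p∈𝒬) (λ avoids → All.tabulate (avoids _))
  (All.all? (λ p → ¬? (contains? π p)) 𝒬)

prefixes : List ℕ → List (List ℕ)
prefixes []       = [] ∷ []
prefixes (x ∷ xs) = [] ∷ map (x ∷_) (prefixes xs)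

factors : List ℕ → List (List ℕ)
factors []       = [] ∷ []
factors (x ∷ xs) = prefixes (x ∷ xs) ++ factors xs

∈-prefixes : ∀ f suf → f ∈ prefixes (f ++ suf)
∈-prefixes []      []      = here refl
∈-prefixes []      (_ ∷ _) = here refl
∈-prefixes (x ∷ f) suf     = there (∈-map⁺ (x ∷_) (∈-prefixes f suf))

Factor⇒∈-factors : ∀ {f π} → Factor f π → f ∈ factors π
Factor⇒∈-factors (pre , suf , refl) = go pre _ suf
  where
  go : ∀ pre f suf → f ∈ factors (pre ++ f ++ suf)
  go []      []      []      = here refl
  go []      []      (_ ∷ _) = here refl
  go []      (x ∷ f) suf     = ∈-++⁺ˡ (∈-prefixes (x ∷ f) suf)
  go (p ∷ pre) f suf         = ∈-++⁺ʳ (prefixes (p ∷ pre ++ f ++ suf)) (go pre f suf)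

-- A necessary condition for Consecutive f that, unlike it, is decidable by inspection.
Compact : List ℕ → Set
Compact f = All (λ x → All (λ y → x < y + length f) f) f

consecutive⇒compact : ∀ {f} → Consecutive f → Compact f
consecutive⇒compact {f} (c , window) = All.tabulate λ x∈f → All.tabulate λ y∈f →
  ≤-trans (proj₂ (Equivalence.to (window _) x∈f)) (+-monoˡ-≤ (length f) (proj₁ (Equivalence.to (window _) y∈f)))

FactorsTrivialOrSpread : List ℕ → Set
FactorsTrivialOrSpread π = All (λ f → Trivial π f ⊎ ¬ Compact f) (factors π)

factorsTrivialOrSpread? : ∀ π → Dec (FactorsTrivialOrSpread π)
factorsTrivialOrSpread? π = All.all? (λ f → trivial? f ⊎-dec ¬? (compact? f)) (factors π)
  where
  trivial? : ∀ f → Dec (Trivial π f)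
  trivial? f = length f ≟ 0 ⊎-dec length f ≟ 1 ⊎-dec length f ≟ length π
  compact? : ∀ f → Dec (Compact f)
  compact? f = All.all? (λ x → All.all? (λ y → x <? y + length f) f) f

factorsTrivialOrSpread⇒simple : ∀ {π} → FactorsTrivialOrSpread π → Simple π
factorsTrivialOrSpread⇒simple checked f (f-factor , f-consecutive) with All.lookup checked (Factor⇒∈-factors f-factor)
... | inj₁ trivial = trivial
... | inj₂ spread  = contradiction (consecutive⇒compact f-consecutive) spread

simple-and-avoiding : ∀ π {_ : True (factorsTrivialOrSpread? π)} {_ : True (avoids? π 𝒫)} → Simple π × Avoids π 𝒫
simple-and-avoiding π {checked} {avoids} = factorsTrivialOrSpread⇒simple (toWitness checked) , toWitness avoids

Listed : List ℕ → Set
Listed π = (π ≡ 1 ∷ 2 ∷ []) ⊎ (π ≡ 2 ∷ 1 ∷ []) ⊎ (π ≡ 3 ∷ 1 ∷ 4 ∷ 2 ∷ []) ⊎ (π ≡ 4 ∷ 1 ∷ 3 ∷ 5 ∷ 2 ∷ [])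

simpleAvoiding⇒listed : ∀ {π} → IsPerm π → 2 ≤ length π → Simple π × Avoids π 𝒫 → Listed π
simpleAvoiding⇒listed π-perm 2≤n (simple , avoids) with m≤n⇒m<n∨m≡n 2≤n
... | inj₂ 2≡n = Sum.map₂ inj₁ (length-2 π-perm (sym 2≡n))
... | inj₁ 3≤n = inj₂ (inj₂ (Classification.classify π-perm 3≤n simple avoids))

listed⇒simpleAvoiding : ∀ {π} → Listed π → Simple π × Avoids π 𝒫
listed⇒simpleAvoiding (inj₁ refl)               = simple-and-avoiding _
listed⇒simpleAvoiding (inj₂ (inj₁ refl))        = simple-and-avoiding _
listed⇒simpleAvoiding (inj₂ (inj₂ (inj₁ refl))) = simple-and-avoiding _
listed⇒simpleAvoiding (inj₂ (inj₂ (inj₂ refl))) = simple-and-avoiding _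

mainTheorem11 : (π : List ℕ) → IsPerm π → 2 ≤ length π →
    ((Simple π × Avoids π 𝒫) ⇔
      ((π ≡ 1 ∷ 2 ∷ []) ⊎ (π ≡ 2 ∷ 1 ∷ []) ⊎ (π ≡ 3 ∷ 1 ∷ 4 ∷ 2 ∷ [])
        ⊎ (π ≡ 4 ∷ 1 ∷ 3 ∷ 5 ∷ 2 ∷ [])))
mainTheorem11 π π-perm 2≤n = mk⇔ (simpleAvoiding⇒listed π-perm 2≤n) listed⇒simpleAvoiding
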